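{- Let $G$ be a semicomplete digraph on $n$ vertices and let $l,k,d$ be positive integers. If $G$ has a set of $l$ pairwise vertex-disjoint directed paths, each from a vertex of $V^+_{\le d}(G)$ to a vertex of $V^+_{\ge d+k}(G)$, then ${\rm pw}(G)\ge\min\{l,k\}$.
   Context: Digraphs are simple; $G$ is semicomplete if between every two distinct vertices there is at least one edge. $d^+(v)$ is the number of out-neighbors of $v$; $V^+_{\le d}(G)$ and $V^+_{\ge d}(G)$ are the sets of vertices with $d^+(v)\le d$ and $d^+(v)\ge d$. A path-decomposition of $G$ is a sequence $(X_1,\dots,X_m)$ of subsets of $V(G)$ with $\bigcup_iX_i=V(G)$, such that for each edge $(u,v)$ there are $i\ge j$ with $u\in X_i$, $v\in X_j$, and each vertex's bags form an integer interval of indices; width is $\max_i|X_i|-1$; ${\rm pw}(G)$ is the minimum width. -}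

module Defs where

open import Data.Nat using (ℕ; suc; _≤_; _<_; _+_)
open import Data.Bool using (Bool; true; false; T)
open import Data.Fin using (Fin)
open import Data.Fin.Subset using (Subset; _∈_; ∣_∣)
open import Data.List using (List; []; _∷_; length; filter; allFin; head; last)
open import Data.List.Relation.Unary.Unique.Propositional using (Unique)
import Data.List.Membership.Propositional as LM
open import Data.Maybe using (Maybe; just)
open import Data.Product using (Σ; ∃; ∃-syntax; _×_; _,_)
open import Data.Sum using (_⊎_)
open import Relation.Nullary using (¬_)
open import Relation.Binary.PropositionalEquality using (_≡_; _≢_)
open import Data.Bool.Properties using (T?)

record Digraph (n : ℕ) : Set where
  field
    E     : Fin n → Fin n → Bool
    loopless : ∀ v → E v v ≡ false
open Digraph public

Edge : ∀ {n} → Digraph n → Fin n → Fin n → Set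
Edge G u v = T (E G u v)

Semicomplete : ∀ {n} → Digraph n → Set
Semicomplete G = ∀ u v → u ≢ v → Edge G u v ⊎ Edge G v u

outdeg : ∀ {n} → Digraph n → Fin n → ℕ
outdeg {n} G u = length (filter (λ v → T? (E G u v)) (allFin n))

Walk : ∀ {n} → Digraph n → List (Fin n) → Set
Walk G [] = Data.Unit.⊤ where import Data.Unit
Walk G (u ∷ []) = Data.Unit.⊤ where import Data.Unit
Walk G (u ∷ v ∷ vs) = Edge G u v × Walk G (v ∷ vs)

record DPath {n : ℕ} (G : Digraph n) (s t : Fin n) : Set where
  field
    verts   : List (Fin n)
    isWalk  : Walk G verts
    distinct : Unique verts
    starts  : head verts ≡ just s
    ends    : last verts ≡ just t

record IsPathDecomposition {n : ℕ} (G : Digraph n) (m : ℕ) (X : Fin m → Subset n) : Set where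
  field
    covers    : ∀ v → ∃[ i ] (v ∈ X i)
    edges     : ∀ u v → Edge G u v →
                ∃[ i ] ∃[ j ] (Data.Fin._≤_ j i × u ∈ X i × v ∈ X j)
    intervals : ∀ v (i j k : Fin m) → Data.Fin._≤_ i j → Data.Fin._≤_ j k →
                v ∈ X i → v ∈ X k → v ∈ X j

PwAtLeast : ∀ {n} → Digraph n → ℕ → Set
PwAtLeast {n} G w = ∀ m (X : Fin m → Subset n) → IsPathDecomposition G m X →
  ∃[ i ] (suc w ≤ ∣ X i ∣)

module Submission where

-- If some bag has more than k vertices we are done, so assume all bags have at most k.
-- Let L q be the set of vertices occurring only in bags before q. Then |L 0| = 0 and
-- |L m| = n > d, so some bag b has |L b| ≤ d < |L (b + 1)|. Every source occurs in a bag
-- ≤ b: otherwise, by semicompleteness, L (b + 1) lies in its out-neighbourhood. Every target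
-- occurs in a bag > b: otherwise its out-neighbourhood is a proper subset of L b ∪ X b, of
-- size < d + k. So each of the l disjoint paths meets X b in a vertex that also occurs after
-- b, while a vertex of L (b + 1) ∖ L b lies in X b but in no later bag: |X b| ≥ l + 1.

open import Defs
open import Data.Nat using (ℕ; _≤_; _+_; _⊓_)
open import Data.Fin using (Fin)
open import Data.List using (List; _∷_)
open import Data.Product using (_×_; Σ)
open import Relation.Binary.PropositionalEquality using (_≢_)
open import Data.List.Membership.Propositional using (_∈_)
open import Data.Empty using (⊥)

open import Data.Bool using (Bool; true; false; T)
open import Data.Bool.Properties using (T?; T-≡)
open import Data.Empty using (⊥-elim)
open import Data.Fin as Fin using (toℕ; fromℕ<)
open import Data.Fin.Properties using (any?; all?; ¬∀⟶∃¬; _≟_; toℕ<n; toℕ-injective; suc-injective; 0≢1+n)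
open import Data.Fin.Subset using (Subset; _⊆_; _⊂_; _∪_; _-_; ∣_∣; ⊤)
  renaming (_∈_ to _∈ₛ_; _∉_ to _∉ₛ_; ⊥ to ∅)
open import Data.Fin.Subset.Properties
  using (_∈?_; ∈⊤; ⊆⊤; ∣⊤∣≡n; ∣⊥∣≡0; p⊆q⇒∣p∣≤∣q∣; p⊂q⇒∣p∣<∣q∣; x∈p∪q⁺; x∈p∪q⁻; x∈p∧x≢y⇒x∈p-y; x∈p⇒∣p-x∣<∣p∣)
import Data.List as List
import Data.Product as Product
open import Data.List.Relation.Unary.Any using (here; there)
open import Data.Maybe using (just)
open import Data.Nat using (zero; suc; _<_; _<?_; _≤?_; s≤s; z≤n)
open import Data.Nat.Properties
  using (≤-refl; ≤-trans; ≤-reflexive; ≤-<-trans; <-≤-trans; <-irrefl; <⇒≤; <⇒≱; ≮⇒≥; m≤n⇒m<n∨m≡n;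
         n≤1+n; +-suc; +-monoʳ-≤; +-mono-≤; m⊓n≤m; m⊓n≤n; m≤m+n; n≤0⇒n≡0; module ≤-Reasoning)
open import Data.Product using (∃-syntax; _,_; proj₁; proj₂)
open import Data.Sum using (inj₁; inj₂; [_,_]; [_,_]′)
open import Data.Vec using (_∷_; []; tabulate)
open import Data.Vec.Properties using (lookup∘tabulate; []=⇒lookup; lookup⇒[]=)
open import Function using (_∘_; id)
open import Function.Bundles using (Equivalence)
open import Function.Definitions using (Injective)
open import Relation.Binary.PropositionalEquality using (_≡_; refl; sym; trans; cong; subst)
open import Relation.Nullary using (¬_; Dec; yes; no)
open import Relation.Nullary.Decidable using (_×-dec_; _→-dec_; ¬?; isYes; toSum; toWitness; fromWitness; decidable-stable)

∈tabulate⁺ : ∀ {n} {f : Fin n → Bool} {x} → T (f x) → x ∈ₛ tabulate f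
∈tabulate⁺ {f = f} {x} fx =
  lookup⇒[]= x (tabulate f) (trans (lookup∘tabulate f x) (Equivalence.to T-≡ fx))

∈tabulate⁻ : ∀ {n} {f : Fin n → Bool} {x} → x ∈ₛ tabulate f → T (f x)
∈tabulate⁻ {f = f} {x} x∈ =
  Equivalence.from T-≡ (trans (sym (lookup∘tabulate f x)) ([]=⇒lookup x∈))

∣p∪q∣≤∣p∣+∣q∣ : ∀ {n} (p q : Subset n) → ∣ p ∪ q ∣ ≤ ∣ p ∣ + ∣ q ∣
∣p∪q∣≤∣p∣+∣q∣ [] [] = z≤n
∣p∪q∣≤∣p∣+∣q∣ (true ∷ p) (true ∷ q) =
  s≤s (≤-trans (∣p∪q∣≤∣p∣+∣q∣ p q) (+-monoʳ-≤ ∣ p ∣ (n≤1+n ∣ q ∣)))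
∣p∪q∣≤∣p∣+∣q∣ (true ∷ p) (false ∷ q) = s≤s (∣p∪q∣≤∣p∣+∣q∣ p q)
∣p∪q∣≤∣p∣+∣q∣ (false ∷ p) (true ∷ q) rewrite +-suc ∣ p ∣ ∣ q ∣ = s≤s (∣p∪q∣≤∣p∣+∣q∣ p q)
∣p∪q∣≤∣p∣+∣q∣ (false ∷ p) (false ∷ q) = ∣p∪q∣≤∣p∣+∣q∣ p q

∣p∣<∣q∣⇒∃x∈q∖p : ∀ {n} {p q : Subset n} → ∣ p ∣ < ∣ q ∣ → ∃[ x ] (x ∈ₛ q × x ∉ₛ p)
∣p∣<∣q∣⇒∃x∈q∖p {n} {p} {q} ∣p∣<∣q∣
  with ¬∀⟶∃¬ n (λ x → x ∈ₛ q → x ∈ₛ p) (λ x → x ∈? q →-dec x ∈? p)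
         (λ q⊆p → <⇒≱ ∣p∣<∣q∣ (p⊆q⇒∣p∣≤∣q∣ (q⊆p _)))
... | x , q⊈p with x ∈? q
...   | yes x∈q = x , x∈q , λ x∈p → q⊈p (λ _ → x∈p)
...   | no x∉q = ⊥-elim (q⊈p (⊥-elim ∘ x∉q))

injective⇒≤∣p∣ : ∀ {l n} {p : Subset n} (y : Fin l → Fin n) →
  Injective _≡_ _≡_ y → (∀ i → y i ∈ₛ p) → l ≤ ∣ p ∣
injective⇒≤∣p∣ {zero} _ _ _ = z≤n
injective⇒≤∣p∣ {suc l} y y-inj y∈p =
  ≤-trans (s≤s (injective⇒≤∣p∣ (y ∘ Fin.suc) (suc-injective ∘ y-inj) y∘suc∈p-y₀))
          (x∈p⇒∣p-x∣<∣p∣ (y∈p Fin.zero))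
  where
  y∘suc∈p-y₀ : ∀ i → y (Fin.suc i) ∈ₛ _ - y Fin.zero
  y∘suc∈p-y₀ i = x∈p∧x≢y⇒x∈p-y (y∈p (Fin.suc i)) (λ eq → 0≢1+n (y-inj (sym eq)))

threshold-crossing : ∀ {d} N (g : ℕ → ℕ) → g 0 ≤ d → d < g N →
  ∃[ b ] (g (toℕ {N} b) ≤ d × d < g (suc (toℕ b)))
threshold-crossing zero g g0≤d d<g0 = ⊥-elim (<-irrefl refl (<-≤-trans d<g0 g0≤d))
threshold-crossing {d} (suc N) g g0≤d d<gN with d <? g 1
... | yes d<g1 = Fin.zero , g0≤d , d<g1
... | no d≮g1 =
  let b , below , above = threshold-crossing N (λ q → g (suc q)) (≮⇒≥ d≮g1) d<gN
  in Fin.suc b , below , above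

out : ∀ {n} → Digraph n → Fin n → Subset n
out G u = tabulate (E G u)

length-filter-tabulate : ∀ {M} (f : Fin M → Bool) {n} (g : Fin n → Fin M) →
  List.length (List.filter (T? ∘ f) (List.tabulate g)) ≡ ∣ tabulate (f ∘ g) ∣
length-filter-tabulate f {zero} g = refl
length-filter-tabulate f {suc n} g with f (g Fin.zero)
... | true = cong suc (length-filter-tabulate f (g ∘ Fin.suc))
... | false = length-filter-tabulate f (g ∘ Fin.suc)

outdeg≡∣out∣ : ∀ {n} (G : Digraph n) u → outdeg G u ≡ ∣ out G u ∣
outdeg≡∣out∣ G u = length-filter-tabulate (E G u) id

∉out-self : ∀ {n} (G : Digraph n) u → u ∉ₛ out G u
∉out-self G u u∈ = subst T (loopless G u) (∈tabulate⁻ u∈)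

∣out∣<n : ∀ {n} (G : Digraph n) u → ∣ out G u ∣ < n
∣out∣<n {n} G u =
  ≤-trans (p⊂q⇒∣p∣<∣q∣ (⊆⊤ , u , ∈⊤ , ∉out-self G u)) (≤-reflexive (∣⊤∣≡n n))

VertexDisjoint : ∀ {n l} {G : Digraph n} {s t : Fin l → Fin n} →
  ((i : Fin l) → DPath G (s i) (t i)) → Set
VertexDisjoint P = ∀ i j → i ≢ j → ∀ v → v ∈ DPath.verts (P i) → v ∈ DPath.verts (P j) → ⊥

module PathDecomposition {n m} {G : Digraph n} {X : Fin m → Subset n}
  (pd : IsPathDecomposition G m X) where

  open IsPathDecomposition pd

  OccursUpTo OccursAfter : Fin m → Fin n → Set
  OccursUpTo b v = ∃[ j ] (j Fin.≤ b × v ∈ₛ X j)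
  OccursAfter b v = ∃[ j ] (b Fin.< j × v ∈ₛ X j)

  occursUpTo? : ∀ b v → Dec (OccursUpTo b v)
  occursUpTo? b v = any? (λ j → (j Fin.≤? b) ×-dec (v ∈? X j))

  occursAfter? : ∀ b v → Dec (OccursAfter b v)
  occursAfter? b v = any? (λ j → (b Fin.<? j) ×-dec (v ∈? X j))

  OnlyBefore : ℕ → Fin n → Set
  OnlyBefore q v = ∀ j → q ≤ toℕ j → v ∉ₛ X j

  onlyBefore? : ∀ q v → Dec (OnlyBefore q v)
  onlyBefore? q v = all? (λ j → (q ≤? toℕ j) →-dec ¬? (v ∈? X j))

  onlyBefore : ℕ → Subset n
  onlyBefore q = tabulate (λ v → isYes (onlyBefore? q v))

  ∈onlyBefore⁺ : ∀ {q v} → OnlyBefore q v → v ∈ₛ onlyBefore q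
  ∈onlyBefore⁺ {q} {v} = ∈tabulate⁺ ∘ fromWitness {a? = onlyBefore? q v}

  ∈onlyBefore⁻ : ∀ {q v} → v ∈ₛ onlyBefore q → OnlyBefore q v
  ∈onlyBefore⁻ {q} {v} = toWitness {a? = onlyBefore? q v} ∘ ∈tabulate⁻

  ∣onlyBefore0∣≡0 : ∣ onlyBefore 0 ∣ ≡ 0
  ∣onlyBefore0∣≡0 = n≤0⇒n≡0 (≤-trans (p⊆q⇒∣p∣≤∣q∣ nowhere) (≤-reflexive (∣⊥∣≡0 n)))
    where
    nowhere : onlyBefore 0 ⊆ ∅
    nowhere {v} v∈ = ⊥-elim (let j , v∈Xj = covers v in ∈onlyBefore⁻ v∈ j z≤n v∈Xj)

  n≤∣onlyBefore-m∣ : n ≤ ∣ onlyBefore m ∣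
  n≤∣onlyBefore-m∣ = subst (_≤ ∣ onlyBefore m ∣) (∣⊤∣≡n n)
    (p⊆q⇒∣p∣≤∣q∣ {p = ⊤} (λ _ → ∈onlyBefore⁺ (λ j m≤j _ → <⇒≱ (toℕ<n j) m≤j)))

  ¬occursAfter⇒bag≤ : ∀ {b v i} → ¬ OccursAfter b v → v ∈ₛ X i → i Fin.≤ b
  ¬occursAfter⇒bag≤ {i = i} late v∈Xi = ≮⇒≥ (λ b<i → late (i , b<i , v∈Xi))

  ¬occursAfter⇒occursUpTo : ∀ {b v} → ¬ OccursAfter b v → OccursUpTo b v
  ¬occursAfter⇒occursUpTo {v = v} late =
    let j , v∈Xj = covers v in j , ¬occursAfter⇒bag≤ late v∈Xj , v∈Xj

  occursUpTo-successor : ∀ {b u v} → ¬ OccursAfter b v → Edge G v u → OccursUpTo b u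
  occursUpTo-successor {u = u} {v} late e =
    let i , j , j≤i , v∈Xi , u∈Xj = edges v u e
    in j , ≤-trans j≤i (¬occursAfter⇒bag≤ late v∈Xi) , u∈Xj

  occursUpTo∧occursAfter⇒∈bag : ∀ {b v} → OccursUpTo b v → OccursAfter b v → v ∈ₛ X b
  occursUpTo∧occursAfter⇒∈bag {b} {v} (i , i≤b , v∈Xi) (j , b<j , v∈Xj) =
    intervals v i b j i≤b (<⇒≤ b<j) v∈Xi v∈Xj

  occursUpTo⇒∈onlyBefore∪bag : ∀ {b v} → OccursUpTo b v → v ∈ₛ onlyBefore (toℕ b) ∪ X b
  occursUpTo⇒∈onlyBefore∪bag {b} {v} early with v ∈? X b
  ... | yes v∈Xb = x∈p∪q⁺ (inj₂ v∈Xb)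
  ... | no v∉Xb = x∈p∪q⁺ (inj₁ (∈onlyBefore⁺ not-from-b))
    where
    not-from-b : OnlyBefore (toℕ b) v
    not-from-b j b≤j v∈Xj with m≤n⇒m<n∨m≡n b≤j
    ... | inj₁ b<j = v∉Xb (occursUpTo∧occursAfter⇒∈bag early (j , b<j , v∈Xj))
    ... | inj₂ b≡j = v∉Xb (subst (λ i → v ∈ₛ X i) (sym (toℕ-injective b≡j)) v∈Xj)

  walk-meets-bag : ∀ {b a z} vs → Walk G vs → List.head vs ≡ just a → List.last vs ≡ just z →
    OccursUpTo b a → OccursAfter b z → ∃[ x ] (x ∈ vs × x ∈ₛ X b × OccursAfter b x)
  walk-meets-bag List.[] _ () _ _ _
  walk-meets-bag (v ∷ List.[]) _ refl refl early late =
    v , here refl , occursUpTo∧occursAfter⇒∈bag early late , late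
  walk-meets-bag {b} (v ∷ u ∷ vs) (v→u , walk) refl end early late =
    [ (λ v-late → v , here refl , occursUpTo∧occursAfter⇒∈bag early v-late , v-late)
    , (λ v-not-late → Product.map₂ (Product.map₁ there)
         (walk-meets-bag (u ∷ vs) walk refl end (occursUpTo-successor v-not-late v→u) late))
    ]′ (toSum (occursAfter? b v))

  path-meets-bag : ∀ {b s t} (P : DPath G s t) → OccursUpTo b s → OccursAfter b t →
    ∃[ x ] (x ∈ DPath.verts P × x ∈ₛ X b × OccursAfter b x)
  path-meets-bag P = walk-meets-bag (DPath.verts P) (DPath.isWalk P) (DPath.starts P) (DPath.ends P)

  onlyBefore⊆out : Semicomplete G → ∀ {b s} → ¬ OccursUpTo b s →
    onlyBefore (suc (toℕ b)) ⊆ out G s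
  onlyBefore⊆out sc {b} {s} s-late {w} w∈ =
    [ ∈tabulate⁺ {f = E G s}
    , (λ w→s → ⊥-elim (s-late (occursUpTo-successor w-early w→s)))
    ] (sc s w s≢w)
    where
    w-early : ¬ OccursAfter b w
    w-early (j , b<j , w∈Xj) = ∈onlyBefore⁻ w∈ j b<j w∈Xj
    s≢w : s ≢ w
    s≢w refl = s-late (¬occursAfter⇒occursUpTo w-early)

  out⊂onlyBefore∪bag : ∀ {b t} → ¬ OccursAfter b t → out G t ⊂ onlyBefore (toℕ b) ∪ X b
  out⊂onlyBefore∪bag {t = t} t-early =
    (λ t→w → occursUpTo⇒∈onlyBefore∪bag (occursUpTo-successor t-early (∈tabulate⁻ t→w))) ,
    t , occursUpTo⇒∈onlyBefore∪bag (¬occursAfter⇒occursUpTo t-early) , ∉out-self G t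

  source-occursUpTo : Semicomplete G → ∀ {b s d} → d < ∣ onlyBefore (suc (toℕ b)) ∣ →
    outdeg G s ≤ d → OccursUpTo b s
  source-occursUpTo sc {b} {s} {d} d<∣onlyBefore∣ s-low =
    decidable-stable (occursUpTo? b s) λ s-late → <⇒≱ d<∣onlyBefore∣ (begin
      ∣ onlyBefore (suc (toℕ b)) ∣ ≤⟨ p⊆q⇒∣p∣≤∣q∣ (onlyBefore⊆out sc s-late) ⟩
      ∣ out G s ∣                  ≡⟨ sym (outdeg≡∣out∣ G s) ⟩
      outdeg G s                   ≤⟨ s-low ⟩
      d                            ∎)
    where open ≤-Reasoning

  target-occursAfter : ∀ {b t d k} → ∣ onlyBefore (toℕ b) ∣ ≤ d → ∣ X b ∣ ≤ k →
    d + k ≤ outdeg G t → OccursAfter b t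
  target-occursAfter {b} {t} {d} {k} ∣onlyBefore∣≤d ∣Xb∣≤k t-high =
    decidable-stable (occursAfter? b t) λ t-early → <⇒≱ (begin-strict
      ∣ out G t ∣                          <⟨ p⊂q⇒∣p∣<∣q∣ (out⊂onlyBefore∪bag t-early) ⟩
      ∣ onlyBefore (toℕ b) ∪ X b ∣         ≤⟨ ∣p∪q∣≤∣p∣+∣q∣ (onlyBefore (toℕ b)) (X b) ⟩
      ∣ onlyBefore (toℕ b) ∣ + ∣ X b ∣     ≤⟨ +-mono-≤ ∣onlyBefore∣≤d ∣Xb∣≤k ⟩
      d + k                                ≤⟨ t-high ⟩
      outdeg G t                           ≡⟨ outdeg≡∣out∣ G t ⟩
      ∣ out G t ∣                          ∎) ≤-refl
    where open ≤-Reasoning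

  early-vertex-in-bag : ∀ {b} → ∣ onlyBefore (toℕ b) ∣ < ∣ onlyBefore (suc (toℕ b)) ∣ →
    ∃[ w ] (w ∈ₛ X b × ¬ OccursAfter b w)
  early-vertex-in-bag {b} grows =
    let w , w∈new , w∉old = ∣p∣<∣q∣⇒∃x∈q∖p grows
        w-early : ¬ OccursAfter b w
        w-early (j , b<j , w∈Xj) = ∈onlyBefore⁻ w∈new j b<j w∈Xj
    in w , [ ⊥-elim ∘ w∉old , id ]′
             (x∈p∪q⁻ (onlyBefore (toℕ b)) (X b)
               (occursUpTo⇒∈onlyBefore∪bag (¬occursAfter⇒occursUpTo w-early))) ,
       w-early

  crossed-bag-large : ∀ {l b w} {s t : Fin l → Fin n} (P : ∀ i → DPath G (s i) (t i)) →
    VertexDisjoint P → (∀ i → OccursUpTo b (s i)) → (∀ i → OccursAfter b (t i)) →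
    w ∈ₛ X b → ¬ OccursAfter b w → suc l ≤ ∣ X b ∣
  crossed-bag-large {b = b} {w} P disjoint s-early t-late w∈Xb w-early =
    ≤-trans (s≤s (injective⇒≤∣p∣ x x-injective x∈Xb-w)) (x∈p⇒∣p-x∣<∣p∣ w∈Xb)
    where
    meets : ∀ i → ∃[ x ] (x ∈ DPath.verts (P i) × x ∈ₛ X b × OccursAfter b x)
    meets i = path-meets-bag (P i) (s-early i) (t-late i)

    x : Fin _ → Fin n
    x = proj₁ ∘ meets

    x-injective : Injective _≡_ _≡_ x
    x-injective {i} {j} xi≡xj with i ≟ j
    ... | yes i≡j = i≡j
    ... | no i≢j = ⊥-elim (disjoint i j i≢j (x i) (proj₁ (proj₂ (meets i)))
                     (subst (_∈ DPath.verts (P j)) (sym xi≡xj) (proj₁ (proj₂ (meets j)))))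

    x∈Xb-w : ∀ i → x i ∈ₛ X b - w
    x∈Xb-w i = x∈p∧x≢y⇒x∈p-y (proj₁ (proj₂ (proj₂ (meets i))))
                 (λ { refl → w-early (proj₂ (proj₂ (proj₂ (meets i)))) })

  wide-bag : Semicomplete G → ∀ {l k d} {s t : Fin l → Fin n} (P : ∀ i → DPath G (s i) (t i)) →
    (∀ i → outdeg G (s i) ≤ d) → (∀ i → d + k ≤ outdeg G (t i)) → VertexDisjoint P →
    Fin l → (∀ b → ∣ X b ∣ ≤ k) → ∃[ b ] (suc l ≤ ∣ X b ∣)
  wide-bag sc {k = k} {d} {t = t} P s-low t-high disjoint i₀ narrow =
    let b , ∣onlyBefore∣≤d , d<∣onlyBefore∣ = threshold-crossing m (λ q → ∣ onlyBefore q ∣)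
                                                (subst (_≤ d) (sym ∣onlyBefore0∣≡0) z≤n) d<∣onlyBefore-m∣
        w , w∈Xb , w-early = early-vertex-in-bag (≤-<-trans ∣onlyBefore∣≤d d<∣onlyBefore∣)
    in b , crossed-bag-large P disjoint
             (λ i → source-occursUpTo sc d<∣onlyBefore∣ (s-low i))
             (λ i → target-occursAfter ∣onlyBefore∣≤d (narrow b) (t-high i))
             w∈Xb w-early
    where
    d<∣onlyBefore-m∣ : d < ∣ onlyBefore m ∣
    d<∣onlyBefore-m∣ = begin-strict
      d                   ≤⟨ m≤m+n d k ⟩
      d + k               ≤⟨ t-high i₀ ⟩
      outdeg G (t i₀)     ≡⟨ outdeg≡∣out∣ G (t i₀) ⟩
      ∣ out G (t i₀) ∣    <⟨ ∣out∣<n G (t i₀) ⟩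
      n                   ≤⟨ n≤∣onlyBefore-m∣ ⟩
      ∣ onlyBefore m ∣    ∎
      where open ≤-Reasoning

open PathDecomposition using (wide-bag)

lemma11 : (n : ℕ) (G : Digraph n) → Semicomplete G →
    (l k d : ℕ) → 1 ≤ l → 1 ≤ k → 1 ≤ d →
    (s t : Fin l → Fin n) →
    (P : (i : Fin l) → DPath G (s i) (t i)) →
    (∀ i → outdeg G (s i) ≤ d) →
    (∀ i → d + k ≤ outdeg G (t i)) →
    (∀ i j → i ≢ j → ∀ v → v ∈ DPath.verts (P i) → v ∈ DPath.verts (P j) → ⊥) →
    PwAtLeast G (l ⊓ k)
lemma11 n G sc l k d 1≤l _ _ s t P s-low t-high disjoint m X pd
  with any? (λ b → k <? ∣ X b ∣)
... | yes (b , k<∣Xb∣) = b , ≤-trans (s≤s (m⊓n≤n l k)) k<∣Xb∣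
... | no no-bag-exceeds-k =
  let b , l<∣Xb∣ = wide-bag pd sc P s-low t-high disjoint (fromℕ< 1≤l)
                     (λ b → ≮⇒≥ (no-bag-exceeds-k ∘ (b ,_)))
  in b , ≤-trans (s≤s (m⊓n≤m l k)) l<∣Xb∣
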